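{- Let $n$ be a positive integer and let $I = \mathcal{I}(R_0)$ for some rack $R_0$ on $[n]$. For $1\leqslant q\leqslant n$ let $\eta_q$ denote the number of vertices of $[n]$ lying in components of the graph $G_{T(R_0)}$ (of the rack $R_0$) of size exactly $q$, and set \[ \zeta^I = \Bigl(\sum_{p=1}^n \frac{\eta_p}{p}\Bigr)\Bigl(\sum_{q=1}^n \frac{\log_2 q}{q}\,\eta_q\Bigr). \] Then there are at most $2^{\zeta^I}$ racks $R$ on $[n]$ such that $\mathcal{I}(R) = I$.
   Context: Maps are written on the right. A rack on $[n]$ is given by a binary operation $\triangleright$ on $[n]$; equivalently by maps $(f_y)_{y\in[n]}$, $(x)f_y = x\triangleright y$, each a permutation of $[n]$, with $f_{(y)f_z} = f_z^{ -1}f_yf_z$ for all $y,z$. For $S\subseteq[n]$, $G_S$ is the directed loopless multigraph on $[n]$ with an edge of colour $y$ from $x$ to $z$ iff $y\in S$, $x\neq z$ and $(x)f_y = z$; components are those of the underlying undirected multigraph, $\mathrm{cp}(G)$ the number of components. For $T\subseteq[n]$ let $\Gamma_T^+(v) = \{(v)f_j : j\in T,\ (v)f_j\neq v\}$, $\Gamma_T^+(V)=\bigcup_{v\in V}\Gamma_T^+(v)$, $d_T^+(v)=|\Gamma_T^+(v)|$, $d_R^+=d_{[n]}^+$, $\Gamma_R^+=\Gamma_{[n]}^+$. Let $\Delta=(\log_2 n)^3$, $L=\lfloor(\log_2 n)^2\rfloor$, $S_{\leqslant\Delta}(R)=\{v: d_R^+(v)\leqslant\Delta\}$, $S_{>\Delta}(R)=[n]\setminus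 S_{\leqslant\Delta}(R)$. $T(R)$: if $S_{\leqslant\Delta}(R)=\emptyset$ then $T(R)=\emptyset$; otherwise order $S_{\leqslant\Delta}(R)$ greedily as $u_1,u_2,\dots$, each $u_{k+1}$ chosen among remaining $v\in S_{\leqslant\Delta}(R)$ minimising $\mathrm{cp}(G_{\{u_1,\dots,u_k,v\}})$ (ties broken by a fixed rule), and let $T(R)=\{u_1,\dots,u_L\}$ if $|S_{\leqslant\Delta}(R)|\geqslant L$, else $T(R)=S_{\leqslant\Delta}(R)$. $T^+(R)=T(R)\cup\Gamma_R^+(T(R))$. For a multigraph $G$ and multiset $E$ of vertex pairs, $M(G,E)$ is the set of vertex sets $C$ of components of $G$ such that some pair of $E$ joins a vertex of $C$ to a vertex outside $C$. $\overrightarrow{E}_j$ is the edge set of $G_{\{j\}}$, $M_j=M(G_{T(R)},\overrightarrow{E}_j)$, $Y_j=\bigcup_{C\in M_j}C$, $\mathbf{M}=(M_j)_{j\in S_{\leqslant\Delta}(R)\setminus T(R)}$ (increasing order of $j$), $Y=\bigcup_{j\in S_{\leqslant\Delta}(R)\setminus T(R)}Y_j\times\{j\}$. Finally $\mathcal{I}(R)=\bigl(S_{\leqslant\Delta}(R),\ \triangleright|_{[n]\times S_{>\Delta}(R)},\ T(R),\ \triangleright|_{T(R)\times[n]},\ \triangleright|_{[n]\times T^+(R)},\ \mathbf{M},\ \triangleright|_Y\bigr)$. -}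

module Defs where

open import Data.Nat using (ℕ; zero; suc; _+_; _*_; _^_; _⊓_; _/_; _≤_; _<_)
open import Data.Fin using (Fin)
import Data.Fin as Fin
open import Data.Fin.Subset using (Subset; _∈_; _∉_; ∣_∣)
open import Data.List using (List; []; _∷_; length)
open import Data.List.Membership.Propositional using () renaming (_∈_ to _∈ₗ_)
open import Data.Product using (Σ; _×_; _,_)
open import Data.Sum using (_⊎_)
open import Relation.Nullary using (¬_)
open import Relation.Binary.PropositionalEquality using (_≡_; _≢_)
open import Relation.Binary.Construct.Closure.Equivalence using (EqClosure)
open import Function.Bundles using (_⇔_)
open import Function.Definitions using (Bijective)

-- A binary operation on [n] = Fin n ;  x ▷ y = (x) f_y .
Op : ℕ → Set
Op n = Fin n → Fin n → Fin n

-- Rack: every right translation f_y is a permutation, and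
-- f_{(y)f_z} = f_z^{-1} f_y f_z, which (f_z being bijective, maps on the right)
-- is equivalent to  (x ▷ y) ▷ z ≡ (x ▷ z) ▷ (y ▷ z).
record IsRack {n : ℕ} (_▷_ : Op n) : Set where
  field
    perm     : ∀ y → Bijective _≡_ _≡_ (λ x → x ▷ y)
    selfdist : ∀ x y z → (x ▷ y) ▷ z ≡ (x ▷ z) ▷ (y ▷ z)

Card : ∀ {n} → (Fin n → Set) → ℕ → Set
Card {n} P k = Σ (Subset n) λ s → (∀ x → (x ∈ s) ⇔ P x) × ∣ s ∣ ≡ k

-- LeLogPow k n m  ⇔  m ≤ (log₂ n)^k   (for n ≥ 1):
-- every positive rational a/b with (a/b)^k < m satisfies a/b ≤ log₂ n, i.e. 2^a ≤ n^b.
LeLogPow : ℕ → ℕ → ℕ → Set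
LeLogPow k n m = ∀ a b → 0 < b → a ^ k < m * b ^ k → 2 ^ a ≤ n ^ b

FloorLogPow : ℕ → ℕ → ℕ → Set
FloorLogPow k n L = LeLogPow k n L × ¬ LeLogPow k n (suc L)

-- Tie-breaking rule: given the (reversed) list of already chosen vertices and the
-- set of tied minimisers, return the chosen vertex.
Rule : ℕ → Set
Rule n = List (Fin n) → Subset n → Fin n

module _ {n : ℕ} (_▷_ : Op n) where

  Edge : (Fin n → Set) → Fin n → Fin n → Set
  Edge C x z = Σ (Fin n) λ y → C y × x ≢ z × x ▷ y ≡ z

  Conn : (Fin n → Set) → Fin n → Fin n → Set
  Conn C = EqClosure (Edge C)

  -- cp(G_C) = k  (components counted via their least vertices)
  CP : (Fin n → Set) → ℕ → Set
  CP C k = Card (λ x → ∀ y → Conn C x y → x Fin.≤ y) k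

  OutNbr : Fin n → Fin n → Set
  OutNbr v w = Σ (Fin n) λ j → v ▷ j ≡ w × w ≢ v

  Small : Fin n → Set
  Small v = Σ ℕ λ d → Card (OutNbr v) d × LeLogPow 3 n d

  Ext : List (Fin n) → Fin n → Fin n → Set
  Ext us v y = y ∈ₗ us ⊎ y ≡ v

  Candidate : List (Fin n) → Fin n → Set
  Candidate us v = Small v × ¬ (v ∈ₗ us)

  Minimiser : List (Fin n) → Fin n → Set
  Minimiser us v = Candidate us v ×
    (∀ v' → Candidate us v' → ∀ k k' → CP (Ext us v) k → CP (Ext us v') k' → k ≤ k')

  -- Greedy rule us : us (most recent first) is an initial segment u_k,…,u_1 of the
  -- greedy ordering of S_{≤Δ}(R).
  data Greedy (rule : Rule n) : List (Fin n) → Set where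
    start : Greedy rule []
    step  : ∀ {us} (M : Subset n) → Greedy rule us →
            (∀ v → (v ∈ M) ⇔ Minimiser us v) → Greedy rule (rule us M ∷ us)

  IsT : Rule n → Subset n → Set
  IsT rule T = Σ ℕ λ L → Σ ℕ λ s → FloorLogPow 2 n L × Card Small s ×
    Σ (List (Fin n)) λ us → Greedy rule us × length us ≡ L ⊓ s ×
      (∀ x → (x ∈ T) ⇔ (x ∈ₗ us))

  InT : Subset n → Fin n → Set
  InT T y = y ∈ T

  InTplus : Subset n → Fin n → Set
  InTplus T y = y ∈ T ⊎ Σ (Fin n) λ v → v ∈ T × OutNbr v y

  MjMem : Subset n → Fin n → Subset n → Set
  MjMem T j C =
    (Σ (Fin n) λ x → ∀ y → (y ∈ C) ⇔ Conn (InT T) x y) ×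
    (Σ (Fin n) λ a → Σ (Fin n) λ b → a ▷ j ≡ b × a ≢ b ×
       ((a ∈ C × b ∉ C) ⊎ (b ∈ C × a ∉ C)))

  Eta : Subset n → ℕ → ℕ → Set
  Eta T q e = Card (λ x → Card (Conn (InT T) x) q) e

-- SameI rule R R₀ :  𝓘(R) = 𝓘(R₀)  (componentwise equality of the 7-tuple)
SameI : ∀ {n} → Rule n → Op n → Op n → Set
SameI {n} rule R R₀ = Σ (Subset n) λ T → IsT R rule T × IsT R₀ rule T ×
  (∀ v → Small R v ⇔ Small R₀ v) ×
  (∀ x y → ¬ Small R₀ y → R x y ≡ R₀ x y) ×
  (∀ x y → x ∈ T → R x y ≡ R₀ x y) ×
  (∀ y → InTplus R T y ⇔ InTplus R₀ T y) ×
  (∀ x y → InTplus R₀ T y → R x y ≡ R₀ x y) ×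
  (∀ j → Small R₀ j → j ∉ T → ∀ C → MjMem R T j C ⇔ MjMem R₀ T j C) ×
  (∀ j x → Small R₀ j → j ∉ T → (Σ (Subset n) λ C → MjMem R₀ T j C × x ∈ C) →
     R x j ≡ R₀ x j)

-- A = Σ_{p=1}^{N} η_p / p   (η_p / p is the number of components of size p)
numComps : (ℕ → ℕ) → ℕ → ℕ
numComps η zero = 0
numComps η (suc N) = numComps η N + η (suc N) / suc N

prodBound : (ℕ → ℕ) → ℕ → ℕ → ℕ
prodBound η A zero = 1
prodBound η A (suc N) = prodBound η A N * suc N ^ ((η (suc N) / suc N) * A)

-- 2^{ζ^I} = ∏_{q=1}^{n} q^{(η_q/q)·A}, since 2^{A (η_q/q) log₂ q} = q^{A η_q/q}
twoPowZeta : (ℕ → ℕ) → ℕ → ℕ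
twoPowZeta η n = prodBound η (numComps η n) n

{-# OPTIONS --safe #-}
-- Write T = T(R₀) and let R be a rack with 𝓘(R) = 𝓘(R₀).  Then R agrees with R₀ on the rows
-- of T and on the columns of T⁺, and self-distributivity transports values along an edge
-- x → x ▷₀ t (t ∈ T) of G_T:  (x ▷₀ t) ▷ j = (x ▷ j) ▷₀ (t ▷₀ j)  and
-- (w ▷₀ t) ▷ (j ▷₀ t) = (w ▷ j) ▷₀ t.  As the right translations of R₀ are bijections, R is
-- determined by its entries b ▷ k with b, k in a set of representatives of the components of
-- G_T.  Such an entry equals b ▷₀ k unless b ▷ k and b ▷₀ k both lie in the component C_b of b,
-- for otherwise C_b ∈ M_k and b ∈ Y_k.  Hence there are at most (∏_b |C_b|)^c such racks, c the
-- number of components; grouping the components by size q bounds ∏_b |C_b| by ∏_q q^(η_q/q) and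
-- c by Σ_p η_p/p, which is the bound 2^(ζ^I).
module Submission where

open import Defs
import Algebra.Properties.CommutativeSemigroup as CommutativeSemigroupProperties
open import Data.Empty using (⊥-elim)
open import Data.Fin using (Fin)
import Data.Fin as Fin
open import Data.Fin.Properties using (any?; _≟_)
import Data.Fin.Properties as Fin
open import Data.Fin.Subset using (Subset; _∈_; _∉_; _⊆_; ∣_∣; ⁅_⁆; inside; outside; Nonempty)
open import Data.Fin.Subset.Properties
  using (_∈?_; x∈⁅x⁆; x∈⁅y⁆⇒x≡y; ∣⁅x⁆∣≡1; p⊂q⇒∣p∣<∣q∣; p⊆q⇒∣p∣≤∣q∣; ∣p∣≤n; ⊆-antisym)
open import Data.List
  using ( List; []; _∷_; length; map; filter; foldr; _++_; allFin; deduplicate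
        ; cartesianProductWith; cartesianProduct)
open import Data.List.Properties
  using (length-map; length-++; filter-notAll; map-∘; map-++; ≡-dec; ∷-injective)
open import Data.List.Membership.Propositional using (find) renaming (_∈_ to _∈ₗ_; _∉_ to _∉ₗ_)
open import Data.List.Membership.Propositional.Properties
  using (∈-filter⁺; ∈-map⁺; ∈-map⁻; ∈-++⁻; ∈-allFin; ∈-cartesianProductWith⁺; ∈-cartesianProduct⁺)
open import Data.List.Relation.Binary.Disjoint.Propositional using (Disjoint)
open import Data.List.Relation.Binary.Subset.Propositional using () renaming (_⊆_ to _⊆ₗ_)
open import Data.List.Relation.Unary.All using (All; []; _∷_)
import Data.List.Relation.Unary.All as All
open import Data.List.Relation.Unary.All.Properties using (all-filter)
open import Data.List.Relation.Unary.AllPairs using (AllPairs; []; _∷_)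
import Data.List.Relation.Unary.AllPairs as AllPairs
import Data.List.Relation.Unary.AllPairs.Properties as AllPairs
open import Data.List.Relation.Unary.Any using (here; there)
import Data.List.Relation.Unary.Any as Any
import Data.List.Relation.Unary.Any.Properties as Any
open import Data.List.Relation.Unary.Unique.Propositional using (Unique)
import Data.List.Relation.Unary.Unique.Propositional.Properties as Unique
open import Data.Nat using (ℕ; zero; suc; _+_; _*_; _^_; _/_; _⊓_; _≤_; _<_; z≤n; s≤s; >-nonZero)
import Data.Nat as ℕ
open import Data.Nat.DivMod using (m*n/n≡m; /-monoˡ-≤)
open import Data.Nat.ListAction using (product)
open import Data.Nat.ListAction.Properties using (product-++)
open import Data.Nat.Properties
  using ( ≤-refl; ≤-reflexive; ≤-trans; ≤-<-trans; <-≤-trans; <-irrefl; <-trans; n<1+n; <-cmp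
        ; <⇒≱; ≤-pred; ≤∧≢⇒<; m≤n⇒m≤1+n; +-mono-≤; *-mono-≤; *-monoˡ-≤; ^-monoˡ-≤; ^-monoʳ-≤; m^n>0
        ; +-suc; +-identityʳ; *-identityʳ; *-assoc; *-comm; *-suc; *-zeroʳ; ^-zeroˡ; ^-*-assoc
        ; *-commutativeSemigroup; module ≤-Reasoning)
  renaming (suc-injective to ℕ-suc-injective)
open import Data.Product using (Σ; ∃; _×_; _,_; proj₁; proj₂)
open import Data.Sum using (_⊎_; inj₁; inj₂)
open import Data.Vec using ([]; _∷_; here; there; tabulate)
open import Data.Vec.Properties using (lookup∘tabulate; []=⇒lookup; lookup⇒[]=)
open import Function using (_∘_)
open import Function.Bundles using (_⇔_; mk⇔; Equivalence)
open import Function.Properties.Equivalence using (⇔-isEquivalence)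
open import Relation.Binary.Core using (Rel)
open import Relation.Binary.Definitions using (Decidable; DecidableEquality; tri<; tri≈; tri>)
open import Relation.Binary.PropositionalEquality
open import Relation.Binary.Construct.Closure.Equivalence using (EqClosure; transitive; symmetric)
import Relation.Binary.Construct.Closure.Equivalence as EqClosure
open import Relation.Binary.Construct.Closure.ReflexiveTransitive using (Star; ε; _◅_; _◅◅_)
open import Relation.Binary.Construct.Closure.Symmetric using (SymClosure; fwd; bwd)
import Relation.Binary.Construct.On as On
open import Relation.Nullary using (Dec; yes; no; does; ¬_; ¬?)
open import Relation.Nullary.Decidable using (_×-dec_; _⊎-dec_; map′; decidable-stable; dec-true)

open Equivalence using (to; from)
open CommutativeSemigroupProperties *-commutativeSemigroup
  using (x∙yz≈y∙xz) renaming (interchange to *-interchange)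

-- Sums and products over 1 … N

∑ : ℕ → (ℕ → ℕ) → ℕ
∑ zero    f = 0
∑ (suc N) f = ∑ N f + f (suc N)

∏ : ℕ → (ℕ → ℕ) → ℕ
∏ zero    f = 1
∏ (suc N) f = ∏ N f * f (suc N)

∑-zero : ∀ N → ∑ N (λ _ → 0) ≡ 0
∑-zero zero    = refl
∑-zero (suc N) = trans (+-identityʳ _) (∑-zero N)

∏-one : ∀ N → ∏ N (λ q → q ^ 0) ≡ 1
∏-one zero    = refl
∏-one (suc N) = trans (*-identityʳ _) (∏-one N)

δ : ℕ → ℕ → ℕ
δ v q with v ℕ.≟ q
... | yes _ = 1
... | no  _ = 0

∑-δ-above : ∀ N {v} (g : ℕ → ℕ) → N < v → ∑ N (λ q → δ v q + g q) ≡ ∑ N g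
∑-δ-above zero    g _ = refl
∑-δ-above (suc N) {v} g N<v with v ℕ.≟ suc N
... | yes refl = ⊥-elim (<-irrefl refl N<v)
... | no  _    = cong (_+ g (suc N)) (∑-δ-above N g (<-trans (n<1+n N) N<v))

∑-δ : ∀ N {v} (g : ℕ → ℕ) → 1 ≤ v → v ≤ N → ∑ N (λ q → δ v q + g q) ≡ suc (∑ N g)
∑-δ zero    g 1≤v v≤0 = ⊥-elim (<-irrefl refl (≤-trans 1≤v v≤0))
∑-δ (suc N) {v} g 1≤v v≤N with v ℕ.≟ suc N
... | yes refl = begin
  ∑ N (λ q → δ (suc N) q + g q) + suc (g (suc N))
    ≡⟨ cong (_+ suc (g (suc N))) (∑-δ-above N g (n<1+n N)) ⟩
  ∑ N g + suc (g (suc N))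
    ≡⟨ +-suc (∑ N g) (g (suc N)) ⟩
  suc (∑ N g + g (suc N)) ∎
  where open ≡-Reasoning
... | no v≢  = cong (_+ g (suc N)) (∑-δ N g 1≤v (≤-pred (≤∧≢⇒< v≤N v≢)))

∏-δ-above : ∀ N {v} (g : ℕ → ℕ) → N < v → ∏ N (λ q → q ^ (δ v q + g q)) ≡ ∏ N (λ q → q ^ g q)
∏-δ-above zero    g _ = refl
∏-δ-above (suc N) {v} g N<v with v ℕ.≟ suc N
... | yes refl = ⊥-elim (<-irrefl refl N<v)
... | no  _    = cong (_* suc N ^ g (suc N)) (∏-δ-above N g (<-trans (n<1+n N) N<v))

∏-δ : ∀ N {v} (g : ℕ → ℕ) → 1 ≤ v → v ≤ N → ∏ N (λ q → q ^ (δ v q + g q)) ≡ v * ∏ N (λ q → q ^ g q)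
∏-δ zero    g 1≤v v≤0 = ⊥-elim (<-irrefl refl (≤-trans 1≤v v≤0))
∏-δ (suc N) {v} g 1≤v v≤N with v ℕ.≟ suc N
... | yes refl = begin
  ∏ N (λ q → q ^ (δ (suc N) q + g q)) * (suc N * suc N ^ g (suc N))
    ≡⟨ cong (_* (suc N * suc N ^ g (suc N))) (∏-δ-above N g (n<1+n N)) ⟩
  ∏ N (λ q → q ^ g q) * (suc N * suc N ^ g (suc N))
    ≡⟨ x∙yz≈y∙xz (∏ N (λ q → q ^ g q)) (suc N) _ ⟩
  suc N * (∏ N (λ q → q ^ g q) * suc N ^ g (suc N)) ∎
  where open ≡-Reasoning
... | no v≢  = trans (cong (_* suc N ^ g (suc N)) (∏-δ N g 1≤v (≤-pred (≤∧≢⇒< v≤N v≢))))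
                     (*-assoc v _ _)

∑-mono-≤ : ∀ N {f g : ℕ → ℕ} → (∀ q → 1 ≤ q → q ≤ N → f q ≤ g q) → ∑ N f ≤ ∑ N g
∑-mono-≤ zero    f≤g = z≤n
∑-mono-≤ (suc N) f≤g =
  +-mono-≤ (∑-mono-≤ N λ q 1≤q q≤N → f≤g q 1≤q (m≤n⇒m≤1+n q≤N)) (f≤g (suc N) (s≤s z≤n) ≤-refl)

∏-mono-≤ : ∀ N {f g : ℕ → ℕ} → (∀ q → 1 ≤ q → q ≤ N → f q ≤ g q) → ∏ N f ≤ ∏ N g
∏-mono-≤ zero    f≤g = ≤-refl
∏-mono-≤ (suc N) f≤g =
  *-mono-≤ (∏-mono-≤ N λ q 1≤q q≤N → f≤g q 1≤q (m≤n⇒m≤1+n q≤N)) (f≤g (suc N) (s≤s z≤n) ≤-refl)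

∏-powers-pos : ∀ N (e : ℕ → ℕ) → 1 ≤ ∏ N (λ q → q ^ e q)
∏-powers-pos zero    e = ≤-refl
∏-powers-pos (suc N) e = *-mono-≤ (∏-powers-pos N e) (m^n>0 (suc N) (e (suc N)))

^-distribʳ-* : ∀ a b c → (a * b) ^ c ≡ a ^ c * b ^ c
^-distribʳ-* a b zero    = refl
^-distribʳ-* a b (suc c) =
  trans (cong (a * b *_) (^-distribʳ-* a b c)) (*-interchange a b (a ^ c) (b ^ c))

∏-powers-^ : ∀ N (e : ℕ → ℕ) A → ∏ N (λ q → q ^ e q) ^ A ≡ ∏ N (λ q → q ^ (e q * A))
∏-powers-^ zero    e A = ^-zeroˡ A
∏-powers-^ (suc N) e A =
  trans (^-distribʳ-* _ _ A) (cong₂ _*_ (∏-powers-^ N e A) (^-*-assoc (suc N) (e (suc N)) A))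

multiplicity : {A : Set} → (A → ℕ) → List A → ℕ → ℕ
multiplicity s []       q = 0
multiplicity s (x ∷ xs) q = δ (s x) q + multiplicity s xs q

module _ {A : Set} (N : ℕ) (s : A → ℕ) where

  length≡∑multiplicity : ∀ {xs} → All (λ x → 1 ≤ s x × s x ≤ N) xs → length xs ≡ ∑ N (multiplicity s xs)
  length≡∑multiplicity {[]}     []                   = sym (∑-zero N)
  length≡∑multiplicity {x ∷ xs} ((1≤sx , sx≤N) ∷ xs∈) =
    trans (cong suc (length≡∑multiplicity xs∈)) (sym (∑-δ N (multiplicity s xs) 1≤sx sx≤N))

  product≡∏multiplicity : ∀ {xs} → All (λ x → 1 ≤ s x × s x ≤ N) xs →
                          product (map s xs) ≡ ∏ N (λ q → q ^ multiplicity s xs q)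
  product≡∏multiplicity {[]}     []                   = sym (∏-one N)
  product≡∏multiplicity {x ∷ xs} ((1≤sx , sx≤N) ∷ xs∈) =
    trans (cong (s x *_) (product≡∏multiplicity xs∈)) (sym (∏-δ N (multiplicity s xs) 1≤sx sx≤N))

-- Counting lists

module _ {A : Set} (_≟_ : DecidableEquality A) where

  Unique∧⊆⇒length≤ : ∀ {xs ys : List A} → Unique xs → xs ⊆ₗ ys → length xs ≤ length ys
  Unique∧⊆⇒length≤ {[]} _ _ = z≤n
  Unique∧⊆⇒length≤ {x ∷ xs} {ys} (x∉xs ∷ xs!) x∷xs⊆ys = begin-strict
    length xs                      ≤⟨ Unique∧⊆⇒length≤ xs! xs⊆ys-x ⟩
    length (filter (_≢? x) ys)     <⟨ filter-notAll (_≢? x) ys (Any.map (λ x≡y x≢y → x≢y (sym x≡y)) x∈ys) ⟩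
    length ys                      ∎
    where
    open ≤-Reasoning
    _≢?_ : ∀ y z → Dec (y ≢ z)
    y ≢? z = ¬? (y ≟ z)
    x∈ys : x ∈ₗ ys
    x∈ys = x∷xs⊆ys (here refl)
    xs⊆ys-x : xs ⊆ₗ filter (_≢? x) ys
    xs⊆ys-x y∈xs = ∈-filter⁺ (_≢? x) (x∷xs⊆ys (there y∈xs)) λ y≡x → All.lookup x∉xs y∈xs (sym y≡x)

module _ {A : Set} where

  choices : List (List A) → List (List A)
  choices = foldr (cartesianProductWith _∷_) ([] ∷ [])

  length-cartesianProductWith : ∀ {B C : Set} (f : A → B → C) xs ys →
                                length (cartesianProductWith f xs ys) ≡ length xs * length ys
  length-cartesianProductWith f []       ys = refl
  length-cartesianProductWith f (x ∷ xs) ys = begin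
    length (map (f x) ys ++ cartesianProductWith f xs ys)   ≡⟨ length-++ (map (f x) ys) ⟩
    length (map (f x) ys) + length (cartesianProductWith f xs ys)
      ≡⟨ cong₂ _+_ (length-map (f x) ys) (length-cartesianProductWith f xs ys) ⟩
    length ys + length xs * length ys ∎
    where open ≡-Reasoning

  length-choices : ∀ xss → length (choices xss) ≡ product (map length xss)
  length-choices []         = refl
  length-choices (xs ∷ xss) =
    trans (length-cartesianProductWith _∷_ xs (choices xss)) (cong (length xs *_) (length-choices xss))

  map∈choices : ∀ {I : Set} (f : I → A) (c : I → List A) is →
                (∀ {i} → i ∈ₗ is → f i ∈ₗ c i) → map f is ∈ₗ choices (map c is)
  map∈choices f c []       _   = here refl
  map∈choices f c (i ∷ is) f∈c =
    ∈-cartesianProductWith⁺ _∷_ (f∈c (here refl)) (map∈choices f c is (f∈c ∘ there))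

product-map-mono-≤ : ∀ {A : Set} {f g : A → ℕ} {xs} → All (λ x → f x ≤ g x) xs →
                     product (map f xs) ≤ product (map g xs)
product-map-mono-≤ []           = ≤-refl
product-map-mono-≤ (fx≤gx ∷ xs) = *-mono-≤ fx≤gx (product-map-mono-≤ xs)

product-map-cartesianProduct : ∀ {A B : Set} (s : B → ℕ) (xs : List A) ys →
  product (map (s ∘ proj₂) (cartesianProduct xs ys)) ≡ product (map s ys) ^ length xs
product-map-cartesianProduct s []       ys = refl
product-map-cartesianProduct s (x ∷ xs) ys = begin
  product (map (s ∘ proj₂) (map (x ,_) ys ++ cartesianProduct xs ys))
    ≡⟨ cong product (map-++ (s ∘ proj₂) (map (x ,_) ys) _) ⟩
  product (map (s ∘ proj₂) (map (x ,_) ys) ++ map (s ∘ proj₂) (cartesianProduct xs ys))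
    ≡⟨ product-++ (map (s ∘ proj₂) (map (x ,_) ys)) _ ⟩
  product (map (s ∘ proj₂) (map (x ,_) ys)) * product (map (s ∘ proj₂) (cartesianProduct xs ys))
    ≡⟨ cong₂ _*_ (cong product (sym (map-∘ ys))) (product-map-cartesianProduct s xs ys) ⟩
  product (map s ys) * product (map s ys) ^ length xs ∎
  where open ≡-Reasoning

All∧AllPairs⇒AllPairs : ∀ {A : Set} {P : A → Set} {R S : A → A → Set} →
                        (∀ {x y} → P x → P y → R x y → S x y) →
                        ∀ {xs} → All P xs → AllPairs R xs → AllPairs S xs
All∧AllPairs⇒AllPairs f []         []         = []
All∧AllPairs⇒AllPairs f (px ∷ pxs) (rx ∷ rxs) =
  All.zipWith (λ (py , rxy) → f px py rxy) (pxs , rx) ∷ All∧AllPairs⇒AllPairs f pxs rxs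

map≡map⇒≡ : ∀ {A B : Set} {f g : A → B} {xs} → map f xs ≡ map g xs → ∀ {x} → x ∈ₗ xs → f x ≡ g x
map≡map⇒≡ {xs = _ ∷ _} fxs≡gxs (here refl) = proj₁ (∷-injective fxs≡gxs)
map≡map⇒≡ {xs = _ ∷ _} fxs≡gxs (there x∈)  = map≡map⇒≡ (proj₂ (∷-injective fxs≡gxs)) x∈

module _ {A I B : Set} (_≟_ : DecidableEquality B)
         (value : A → I → B) (is : List I) (c : I → List B) where

  length≤product-choices : ∀ {as} →
    All (λ a → ∀ {i} → i ∈ₗ is → value a i ∈ₗ c i) as →
    AllPairs (λ a a′ → ¬ (∀ {i} → i ∈ₗ is → value a i ≡ value a′ i)) as →
    length as ≤ product (map (length ∘ c) is)
  length≤product-choices {as} valid distinct = begin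
    length as                          ≡⟨ length-map code as ⟨
    length (map code as)               ≤⟨ Unique∧⊆⇒length≤ (≡-dec _≟_) codes-unique codes⊆choices ⟩
    length (choices (map c is))        ≡⟨ length-choices (map c is) ⟩
    product (map length (map c is))    ≡⟨ cong product (map-∘ is) ⟨
    product (map (length ∘ c) is)      ∎
    where
    open ≤-Reasoning
    code : A → List B
    code a = map (value a) is
    codes-unique : Unique (map code as)
    codes-unique = AllPairs.map⁺ (AllPairs.map (λ differ → differ ∘ map≡map⇒≡) distinct)
    codes⊆choices : map code as ⊆ₗ choices (map c is)
    codes⊆choices m with ∈-map⁻ code m
    ... | a , a∈as , refl = map∈choices (value a) c is (All.lookup valid a∈as)

-- Subsets of Fin n

subset : ∀ {n ℓ} {P : Fin n → Set ℓ} → (∀ x → Dec (P x)) → Subset n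
subset P? = tabulate λ x → does (P? x)

∈-subset : ∀ {n ℓ} {P : Fin n → Set ℓ} (P? : ∀ x → Dec (P x)) {x} → x ∈ subset P? ⇔ P x
∈-subset {P = P} P? {x} = mk⇔ ∈⇒P P⇒∈
  where
  ∈⇒P : x ∈ subset P? → P x
  ∈⇒P x∈ with P? x | trans (sym (lookup∘tabulate _ x)) ([]=⇒lookup x∈)
  ... | yes px | _ = px
  P⇒∈ : P x → x ∈ subset P?
  P⇒∈ px = lookup⇒[]= x _ (trans (lookup∘tabulate _ x) (dec-true (P? x) px))

subset-unique : ∀ {n} {P : Fin n → Set} {s s′ : Subset n} →
                (∀ x → x ∈ s ⇔ P x) → (∀ x → x ∈ s′ ⇔ P x) → s ≡ s′
subset-unique s≡P s′≡P = ⊆-antisym (λ {x} x∈s → from (s′≡P x) (to (s≡P x) x∈s))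
                                   (λ {x} x∈s′ → from (s≡P x) (to (s′≡P x) x∈s′))

1≤∣p∣ : ∀ {n} {p : Subset n} {x} → x ∈ p → 1 ≤ ∣ p ∣
1≤∣p∣ {x = x} x∈p = ≤-trans (≤-reflexive (sym (∣⁅x⁆∣≡1 x)))
                            (p⊆q⇒∣p∣≤∣q∣ λ y∈⁅x⁆ → subst (_∈ _) (sym (x∈⁅y⁆⇒x≡y x y∈⁅x⁆)) x∈p)

members : ∀ {n} → Subset n → List (Fin n)
members []            = []
members (inside  ∷ p) = Fin.zero ∷ map Fin.suc (members p)
members (outside ∷ p) = map Fin.suc (members p)

length-members : ∀ {n} (p : Subset n) → length (members p) ≡ ∣ p ∣
length-members []            = refl
length-members (inside  ∷ p) = cong suc (trans (length-map Fin.suc (members p)) (length-members p))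
length-members (outside ∷ p) = trans (length-map Fin.suc (members p)) (length-members p)

∈-members : ∀ {n} (p : Subset n) {x} → x ∈ₗ members p ⇔ x ∈ p
∈-members p = mk⇔ (∈ₗ⇒∈ p) (∈⇒∈ₗ p)
  where
  ∈ₗ⇒∈ : ∀ {n} (p : Subset n) {x} → x ∈ₗ members p → x ∈ p
  ∈ₗ⇒∈ (inside ∷ p)  (here refl) = here
  ∈ₗ⇒∈ (inside ∷ p)  (there x∈)  with ∈-map⁻ Fin.suc x∈
  ... | y , y∈ , refl = there (∈ₗ⇒∈ p y∈)
  ∈ₗ⇒∈ (outside ∷ p) x∈          with ∈-map⁻ Fin.suc x∈
  ... | y , y∈ , refl = there (∈ₗ⇒∈ p y∈)
  ∈⇒∈ₗ : ∀ {n} (p : Subset n) {x} → x ∈ p → x ∈ₗ members p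
  ∈⇒∈ₗ (inside ∷ p)  here       = here refl
  ∈⇒∈ₗ (inside ∷ p)  (there x∈) = there (∈-map⁺ Fin.suc (∈⇒∈ₗ p x∈))
  ∈⇒∈ₗ (outside ∷ p) (there x∈) = ∈-map⁺ Fin.suc (∈⇒∈ₗ p x∈)

members-unique : ∀ {n} (p : Subset n) → Unique (members p)
members-unique []            = []
members-unique (inside  ∷ p) =
  All.tabulate (λ { x∈ refl → zero∉map-suc x∈ }) ∷ Unique.map⁺ Fin.suc-injective (members-unique p)
  where
  zero∉map-suc : ∀ {n} {xs : List (Fin n)} → Fin.zero ∉ₗ map Fin.suc xs
  zero∉map-suc z∈ with ∈-map⁻ Fin.suc z∈
  ... | _ , _ , ()
members-unique (outside ∷ p) = Unique.map⁺ Fin.suc-injective (members-unique p)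

-- Connected components of a decidable graph

module Reachability {n ℓ} {_⟶_ : Rel (Fin n) ℓ} (_⟶?_ : Decidable _⟶_) where

  InOrAfter : Subset n → Fin n → Set ℓ
  InOrAfter S z = z ∈ S ⊎ ∃ λ w → w ∈ S × w ⟶ z

  inOrAfter? : ∀ S z → Dec (InOrAfter S z)
  inOrAfter? S z = z ∈? S ⊎-dec any? λ w → w ∈? S ×-dec w ⟶? z

  grow : Subset n → Subset n
  grow S = subset (inOrAfter? S)

  ∈-grow : ∀ {S z} → z ∈ grow S ⇔ InOrAfter S z
  ∈-grow {S} = ∈-subset (inOrAfter? S)

  ⊆-grow : ∀ {S} → S ⊆ grow S
  ⊆-grow z∈S = from ∈-grow (inj₁ z∈S)

  grow-mono : ∀ {S S′} → S ⊆ S′ → grow S ⊆ grow S′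
  grow-mono S⊆S′ z∈ with to ∈-grow z∈
  ... | inj₁ z∈S             = from ∈-grow (inj₁ (S⊆S′ z∈S))
  ... | inj₂ (w , w∈S , w⟶z) = from ∈-grow (inj₂ (w , S⊆S′ w∈S , w⟶z))

  Closed : Subset n → Set
  Closed S = grow S ⊆ S

  Closed⇒Star-closed : ∀ {S w y} → Closed S → w ∈ S → Star _⟶_ w y → y ∈ S
  Closed⇒Star-closed closed w∈S ε          = w∈S
  Closed⇒Star-closed closed w∈S (w⟶v ◅ path) =
    Closed⇒Star-closed closed (closed (from ∈-grow (inj₂ (_ , w∈S , w⟶v)))) path

  ball : Fin n → ℕ → Subset n
  ball x zero    = ⁅ x ⁆
  ball x (suc k) = grow (ball x k)

  ball⇒Star : ∀ x k {y} → y ∈ ball x k → Star _⟶_ x y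
  ball⇒Star x zero    y∈ with x∈⁅y⁆⇒x≡y x y∈
  ... | refl = ε
  ball⇒Star x (suc k) y∈ with to ∈-grow y∈
  ... | inj₁ y∈ball             = ball⇒Star x k y∈ball
  ... | inj₂ (w , w∈ball , w⟶y) = ball⇒Star x k w∈ball ◅◅ (w⟶y ◅ ε)

  ball-closed-or-large : ∀ x k → Closed (ball x k) ⊎ k < ∣ ball x k ∣
  ball-closed-or-large x zero = inj₂ (1≤∣p∣ (x∈⁅x⁆ x))
  ball-closed-or-large x (suc k) with ball-closed-or-large x k
  ... | inj₁ closed = inj₁ (grow-mono closed)
  ... | inj₂ large with any? (λ z → z ∈? ball x (suc k) ×-dec ¬? (z ∈? ball x k))
  ...   | yes (z , z∈ , z∉) = inj₂ (≤-<-trans large (p⊂q⇒∣p∣<∣q∣ (⊆-grow , z , z∈ , z∉)))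
  ...   | no  ∄new          = inj₁ (grow-mono closed)
    where
    closed : Closed (ball x k)
    closed {z} z∈ = decidable-stable (z ∈? ball x k) λ z∉ → ∄new (z , z∈ , z∉)

  reach : Fin n → Subset n
  reach x = ball x n

  reach-closed : ∀ x → Closed (reach x)
  reach-closed x with ball-closed-or-large x n
  ... | inj₁ closed = closed
  ... | inj₂ large  = ⊥-elim (<⇒≱ large (∣p∣≤n (reach x)))

  ∈-reach : ∀ {x y} → y ∈ reach x ⇔ Star _⟶_ x y
  ∈-reach {x} = mk⇔ (ball⇒Star x n) (Closed⇒Star-closed (reach-closed x) (x∈ball x n))
    where
    x∈ball : ∀ x k → x ∈ ball x k
    x∈ball x zero    = x∈⁅x⁆ x
    x∈ball x (suc k) = ⊆-grow (x∈ball x k)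

  Star? : Decidable (Star _⟶_)
  Star? x y = map′ (to ∈-reach) (from ∈-reach) (y ∈? reach x)

SymClosure? : ∀ {A : Set} {ℓ} {R : Rel A ℓ} → Decidable R → Decidable (SymClosure R)
SymClosure? R? x y =
  map′ (λ { (inj₁ r) → fwd r ; (inj₂ r) → bwd r }) (λ { (fwd r) → inj₁ r ; (bwd r) → inj₂ r })
       (R? x y ⊎-dec R? y x)

deduplicate-separated : ∀ {A : Set} {ℓ} {R : Rel A ℓ} (R? : Decidable R) xs →
                        AllPairs (λ x y → ¬ R x y) (deduplicate R? xs)
deduplicate-separated R? []       = []
deduplicate-separated R? (x ∷ xs) =
  all-filter (¬? ∘ R? x) (deduplicate R? xs) ∷ AllPairs.filter⁺ (¬? ∘ R? x) (deduplicate-separated R? xs)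

EqClosure-invariant : ∀ {A : Set} {ℓ} {R : Rel A ℓ} (P : A → Set) →
                      (∀ {x y} → R x y → P x ⇔ P y) → ∀ {x y} → EqClosure R x y → P x ⇔ P y
EqClosure-invariant P = EqClosure.fold (On.isEquivalence P ⇔-isEquivalence)

-- The graph G_T of a rack

module Components {n} (_▷_ : Op n) (T : Subset n) where

  _~_ : Fin n → Fin n → Set
  _~_ = Conn _▷_ (InT _▷_ T)

  edge? : Decidable (Edge _▷_ (InT _▷_ T))
  edge? x z = any? λ y → y ∈? T ×-dec ¬? (x ≟ z) ×-dec (x ▷ y ≟ z)

  open Reachability (SymClosure? edge?) public
    using () renaming (reach to component; ∈-reach to ∈-component; Star? to _~?_)

  representatives : List (Fin n)
  representatives = deduplicate _~?_ (allFin n)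

  representative : ∀ x → ∃ λ b → b ∈ₗ representatives × b ~ x
  representative x =
    find (Any.deduplicate⁺ _~?_ (λ b~a a~x → transitive _ b~a a~x)
                                (Any.map (λ { refl → ε }) (∈-allFin x)))

  representatives-separated : AllPairs (λ a b → ¬ a ~ b) representatives
  representatives-separated = deduplicate-separated _~?_ (allFin n)

  x∈component : ∀ x → x ∈ component x
  x∈component x = from ∈-component ε

  size : Fin n → ℕ
  size x = ∣ component x ∣

  size-bounds : ∀ x → 1 ≤ size x × size x ≤ n
  size-bounds x = 1≤∣p∣ (x∈component x) , ∣p∣≤n (component x)

-- Uniqueness of T(R)

Card-unique : ∀ {n} {P : Fin n → Set} {k k′} → Card P k → Card P k′ → k ≡ k′
Card-unique (s , s≡P , refl) (s′ , s′≡P , refl) = cong ∣_∣ (subset-unique s≡P s′≡P)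

LeLogPow-antitone : ∀ {k n m m′} → m′ ≤ m → LeLogPow k n m → LeLogPow k n m′
LeLogPow-antitone {k} m′≤m le a b b>0 aᵏ<m′bᵏ = le a b b>0 (<-≤-trans aᵏ<m′bᵏ (*-monoˡ-≤ (b ^ k) m′≤m))

FloorLogPow-unique : ∀ {k n L L′} → FloorLogPow k n L → FloorLogPow k n L′ → L ≡ L′
FloorLogPow-unique {k} {n} {L} {L′} (L≤ , L+1≰) (L′≤ , L′+1≰) with <-cmp L L′
... | tri< L<L′ _ _ = ⊥-elim (L+1≰ (LeLogPow-antitone {k} {n} L<L′ L′≤))
... | tri≈ _ L≡L′ _ = L≡L′
... | tri> _ _ L>L′ = ⊥-elim (L′+1≰ (LeLogPow-antitone {k} {n} L>L′ L≤))

Greedy-unique : ∀ {n} {R : Op n} {rule : Rule n} {us us′} →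
                Greedy R rule us → Greedy R rule us′ → length us ≡ length us′ → us ≡ us′
Greedy-unique               start                start                  _   = refl
Greedy-unique {rule = rule} (step {us} M g M≡min) (step M′ g′ M′≡min) len
  with Greedy-unique g g′ (ℕ-suc-injective len)
... | refl = cong (λ M → rule us M ∷ us) (subset-unique M≡min M′≡min)

IsT-unique : ∀ {n} {R : Op n} {rule : Rule n} {T T′} → IsT R rule T → IsT R rule T′ → T ≡ T′
IsT-unique (_ , _ , floor , card , _ , greedy , len , T≡us)
           (_ , _ , floor′ , card′ , _ , greedy′ , len′ , T′≡us′)
  with Greedy-unique greedy greedy′
         (trans len (trans (cong₂ _⊓_ (FloorLogPow-unique {2} floor floor′) (Card-unique card card′))
                           (sym len′)))
... | refl = subset-unique T≡us T′≡us′

-- Racks with the same invariant as R₀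

module Fibre {n} (R₀ : Op n) (rack₀ : IsRack R₀) (T : Subset n) where

  open Components R₀ T

  record Matches (R : Op n) : Set where
    field
      isRack        : IsRack R
      rows-T        : ∀ x y → x ∈ T → R x y ≡ R₀ x y
      columns-T⁺    : ∀ x y → InTplus R₀ T y → R x y ≡ R₀ x y
      columns-large : ∀ x y → ¬ Small R₀ y → R x y ≡ R₀ x y
      M-same        : ∀ j → Small R₀ j → j ∉ T → ∀ C → MjMem R T j C ⇔ MjMem R₀ T j C
      on-Y          : ∀ j x → Small R₀ j → j ∉ T → (∃ λ C → MjMem R₀ T j C × x ∈ C) → R x j ≡ R₀ x j

  SameI⇒Matches : ∀ {rule R} → IsT R₀ rule T → IsRack R → SameI rule R R₀ → Matches R
  SameI⇒Matches isT rack (_ , _ , isT′ , _ , large , rows , _ , columns , M , Y)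
    with IsT-unique isT isT′
  ... | refl = record { isRack = rack ; rows-T = rows ; columns-T⁺ = columns
                      ; columns-large = large ; M-same = M ; on-Y = Y }

  ▷₀-injective : ∀ t {x y} → R₀ x t ≡ R₀ y t → x ≡ y
  ▷₀-injective t = proj₁ (IsRack.perm rack₀ t)

  ▷₀-surjective : ∀ t x → ∃ λ w → R₀ w t ≡ x
  ▷₀-surjective t x = let w , w▷t≡x = proj₂ (IsRack.perm rack₀ t) x in w , w▷t≡x refl

  T-row⊆T⁺ : ∀ {t} j → t ∈ T → InTplus R₀ T (R₀ t j)
  T-row⊆T⁺ {t} j t∈T with R₀ t j ≟ t
  ... | yes t▷j≡t = inj₁ (subst (_∈ T) (sym t▷j≡t) t∈T)
  ... | no  t▷j≢t = inj₂ (t , t∈T , j , refl , t▷j≢t)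

  module _ {R} (m : Matches R) where
    open Matches m
    open ≡-Reasoning

    row-transport : ∀ {t x z} j → t ∈ T → R₀ x t ≡ z → R z j ≡ R₀ (R x j) (R₀ t j)
    row-transport {t} {x} j t∈T refl = begin
      R (R₀ x t) j         ≡⟨ cong (λ y → R y j) (columns-T⁺ x t (inj₁ t∈T)) ⟨
      R (R x t) j          ≡⟨ IsRack.selfdist isRack x t j ⟩
      R (R x j) (R t j)    ≡⟨ cong (R (R x j)) (rows-T t j t∈T) ⟩
      R (R x j) (R₀ t j)   ≡⟨ columns-T⁺ (R x j) (R₀ t j) (T-row⊆T⁺ j t∈T) ⟩
      R₀ (R x j) (R₀ t j)  ∎

    column-transport : ∀ {t j j′} w → t ∈ T → R₀ j t ≡ j′ → R (R₀ w t) j′ ≡ R₀ (R w j) t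
    column-transport {t} {j} w t∈T refl = begin
      R (R₀ w t) (R₀ j t)  ≡⟨ cong₂ R (columns-T⁺ w t (inj₁ t∈T)) (columns-T⁺ j t (inj₁ t∈T)) ⟨
      R (R w t) (R j t)    ≡⟨ IsRack.selfdist isRack w j t ⟨
      R (R w j) t          ≡⟨ columns-T⁺ (R w j) t (inj₁ t∈T) ⟩
      R₀ (R w j) t         ∎

  module _ {R R′} (m : Matches R) (m′ : Matches R′) where

    rows-agree-along : ∀ j {x z} → x ~ z → R x j ≡ R′ x j → R z j ≡ R′ z j
    rows-agree-along j x~z = to (EqClosure-invariant (λ x → R x j ≡ R′ x j) along-edge x~z)
      where
      along-edge : ∀ {x z} → Edge R₀ (InT R₀ T) x z → (R x j ≡ R′ x j) ⇔ (R z j ≡ R′ z j)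
      along-edge (t , t∈T , _ , x▷t≡z) = mk⇔
        (λ eq → trans (row-transport m j t∈T x▷t≡z)
                      (trans (cong (λ v → R₀ v (R₀ t j)) eq) (sym (row-transport m′ j t∈T x▷t≡z))))
        (λ eq → ▷₀-injective (R₀ t j) (trans (sym (row-transport m j t∈T x▷t≡z))
                                             (trans eq (row-transport m′ j t∈T x▷t≡z))))

    ColumnsAgree : Fin n → Set
    ColumnsAgree j = ∀ x → R x j ≡ R′ x j

    columns-agree-along : ∀ {j j′} → j ~ j′ → ColumnsAgree j → ColumnsAgree j′
    columns-agree-along j~j′ = to (EqClosure-invariant ColumnsAgree along-edge j~j′)
      where
      along-edge : ∀ {j j′} → Edge R₀ (InT R₀ T) j j′ → ColumnsAgree j ⇔ ColumnsAgree j′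
      along-edge {j} {j′} (t , t∈T , _ , j▷t≡j′) = mk⇔
        (λ agree x → let w , w▷t≡x = ▷₀-surjective t x in
          subst (λ v → R v j′ ≡ R′ v j′) w▷t≡x
            (trans (column-transport m w t∈T j▷t≡j′)
                   (trans (cong (λ v → R₀ v t) (agree w)) (sym (column-transport m′ w t∈T j▷t≡j′)))))
        (λ agree w → ▷₀-injective t (trans (sym (column-transport m w t∈T j▷t≡j′))
                                           (trans (agree (R₀ w t)) (column-transport m′ w t∈T j▷t≡j′))))

    determined-by-representatives :
      (∀ {b k} → b ∈ₗ representatives → k ∈ₗ representatives → R b k ≡ R′ b k) → ∀ x y → R x y ≡ R′ x y
    determined-by-representatives agree x y =
      let k , k∈ , k~y = representative y in
      columns-agree-along k~y (λ x′ → let b , b∈ , b~x′ = representative x′ in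
                                        rows-agree-along k b~x′ (agree b∈ k∈)) x

  leaving⇒M : ∀ {R} x k → (∀ {y} → y ∈ component x ⇔ Conn R (InT R T) x y) →
              R x k ∉ component x → MjMem R T k (component x)
  leaving⇒M {R} x k ∈-component-R out =
    (x , λ _ → ∈-component-R) , x , R x k , refl ,
    (λ x≡x▷k → out (subst (_∈ component x) x≡x▷k (x∈component x))) , inj₁ (x∈component x , out)

  module _ {R} (m : Matches R) where
    open Matches m

    -- Small is not decidable, but equality of values is, and that is all the case split needs.
    agrees-unless-small : ∀ x k → (Small R₀ k → k ∉ T → R x k ≡ R₀ x k) → R x k ≡ R₀ x k
    agrees-unless-small x k small⇒agree with R x k ≟ R₀ x k
    ... | yes agree = agree
    ... | no  differ with k ∈? T
    ...   | yes k∈T = columns-T⁺ x k (inj₁ k∈T)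
    ...   | no  k∉T = ⊥-elim (differ (columns-large x k λ small → differ (small⇒agree small k∉T)))

    ∈-component-R : ∀ {x y} → y ∈ component x ⇔ Conn R (InT R T) x y
    ∈-component-R = mk⇔ (EqClosure.map to-R ∘ to ∈-component) (from ∈-component ∘ EqClosure.map from-R)
      where
      to-R : ∀ {x z} → Edge R₀ (InT R₀ T) x z → Edge R (InT R T) x z
      to-R (t , t∈T , x≢z , x▷t≡z) = t , t∈T , x≢z , trans (columns-T⁺ _ t (inj₁ t∈T)) x▷t≡z
      from-R : ∀ {x z} → Edge R (InT R T) x z → Edge R₀ (InT R₀ T) x z
      from-R (t , t∈T , x≢z , x▷t≡z) = t , t∈T , x≢z , trans (sym (columns-T⁺ _ t (inj₁ t∈T))) x▷t≡z

    leaving₀⇒fixed : ∀ x k → R₀ x k ∉ component x → R x k ≡ R₀ x k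
    leaving₀⇒fixed x k out = agrees-unless-small x k λ small k∉T →
      on-Y k x small k∉T (component x , leaving⇒M x k ∈-component out , x∈component x)

    leaving⇒fixed : ∀ x k → R x k ∉ component x → R x k ≡ R₀ x k
    leaving⇒fixed x k out = agrees-unless-small x k λ small k∉T →
      on-Y k x small k∉T
        (component x , to (M-same k small k∉T _) (leaving⇒M x k ∈-component-R out) , x∈component x)

  allowed : Fin n → Fin n → List (Fin n)
  allowed x k with R₀ x k ∈? component x
  ... | yes _ = members (component x)
  ... | no  _ = R₀ x k ∷ []

  ∈-allowed : ∀ {R} → Matches R → ∀ x k → R x k ∈ₗ allowed x k
  ∈-allowed {R} m x k with R₀ x k ∈? component x
  ... | no  out₀ = here (leaving₀⇒fixed m x k out₀)
  ... | yes in₀ with R x k ∈? component x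
  ...   | yes in′ = from (∈-members _) in′
  ...   | no  out = from (∈-members _) (subst (_∈ component x) (sym (leaving⇒fixed m x k out)) in₀)

  length-allowed≤ : ∀ x k → length (allowed x k) ≤ size x
  length-allowed≤ x k with R₀ x k ∈? component x
  ... | yes _ = ≤-reflexive (length-members (component x))
  ... | no  _ = proj₁ (size-bounds x)

  -- The cell (k , x) stands for the entry x ▷ k; listing the cells column by column
  -- makes their product of sizes a power.
  cells : List (Fin n × Fin n)
  cells = cartesianProduct representatives representatives

  entry : Op n → Fin n × Fin n → Fin n
  entry R (k , x) = R x k

  allowedAt : Fin n × Fin n → List (Fin n)
  allowedAt (k , x) = allowed x k

  fibre-length≤ : ∀ {Rs} → All Matches Rs →
                  AllPairs (λ R R′ → Σ (Fin n) λ x → Σ (Fin n) λ y → R x y ≢ R′ x y) Rs →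
                  length Rs ≤ product (map size representatives) ^ length representatives
  fibre-length≤ {Rs} matches distinct = begin
    length Rs
      ≤⟨ length≤product-choices _≟_ entry cells allowedAt valid distinct′ ⟩
    product (map (length ∘ allowedAt) cells)
      ≤⟨ product-map-mono-≤ {xs = cells} (All.tabulate λ {(k , x)} _ → length-allowed≤ x k) ⟩
    product (map (size ∘ proj₂) cells)
      ≡⟨ product-map-cartesianProduct size representatives representatives ⟩
    product (map size representatives) ^ length representatives ∎
    where
    open ≤-Reasoning
    valid : All (λ R → ∀ {c} → c ∈ₗ cells → entry R c ∈ₗ allowedAt c) Rs
    valid = All.map (λ m {(k , x)} _ → ∈-allowed m x k) matches
    distinct′ : AllPairs (λ R R′ → ¬ (∀ {c} → c ∈ₗ cells → entry R c ≡ entry R′ c)) Rs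
    distinct′ = All∧AllPairs⇒AllPairs
      (λ m m′ (x , y , differ) agree →
        differ (determined-by-representatives m m′ (λ b∈ k∈ → agree (∈-cartesianProduct⁺ k∈ b∈)) x y))
      matches distinct

-- Counting components by size

componentCount : (ℕ → ℕ) → ℕ → ℕ
componentCount η zero    = 0
componentCount η (suc q) = η (suc q) / suc q

numComps≡∑ : ∀ η N → numComps η N ≡ ∑ N (componentCount η)
numComps≡∑ η zero    = refl
numComps≡∑ η (suc N) = cong (_+ componentCount η (suc N)) (numComps≡∑ η N)

prodBound≡∏ : ∀ η A N → prodBound η A N ≡ ∏ N (λ q → q ^ (componentCount η q * A))
prodBound≡∏ η A zero    = refl
prodBound≡∏ η A (suc N) = cong (_* suc N ^ (componentCount η (suc N) * A)) (prodBound≡∏ η A N)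

q*m≤η⇒m≤componentCount : ∀ η {q m} → 1 ≤ q → q * m ≤ η q → m ≤ componentCount η q
q*m≤η⇒m≤componentCount η {suc q} {m} _ qm≤η =
  subst (_≤ η (suc q) / suc q) (m*n/n≡m m (suc q))
        (/-monoˡ-≤ (suc q) (subst (_≤ η (suc q)) (*-comm (suc q) m) qm≤η))

^-≤-twoPowZeta : ∀ η N {X l} → X ≤ ∏ N (λ q → q ^ componentCount η q) → l ≤ numComps η N →
                 X ^ l ≤ twoPowZeta η N
^-≤-twoPowZeta η N {X} {l} X≤Q l≤A = begin
  X ^ l                                      ≤⟨ ^-monoˡ-≤ l X≤Q ⟩
  Q ^ l                                      ≤⟨ ^-monoʳ-≤ Q {{>-nonZero Q≥1}} l≤A ⟩
  Q ^ A                                      ≡⟨ ∏-powers-^ N (componentCount η) A ⟩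
  ∏ N (λ q → q ^ (componentCount η q * A))   ≡⟨ prodBound≡∏ η A N ⟨
  twoPowZeta η N                             ∎
  where
  open ≤-Reasoning
  Q = ∏ N (λ q → q ^ componentCount η q)
  A = numComps η N
  Q≥1 = ∏-powers-pos N (componentCount η)

module ComponentSizes {n} (R₀ : Op n) (T : Subset n) where

  open Components R₀ T

  gather : ℕ → List (Fin n) → List (Fin n)
  gather q []       = []
  gather q (b ∷ bs) with size b ℕ.≟ q
  ... | yes _ = members (component b) ++ gather q bs
  ... | no  _ = gather q bs

  length-gather : ∀ q bs → length (gather q bs) ≡ q * multiplicity size bs q
  length-gather q []       = sym (*-zeroʳ q)
  length-gather q (b ∷ bs) with size b ℕ.≟ q
  ... | no  _       = length-gather q bs
  ... | yes refl = begin
    length (members (component b) ++ gather q bs)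
      ≡⟨ length-++ (members (component b)) ⟩
    length (members (component b)) + length (gather q bs)
      ≡⟨ cong₂ _+_ (length-members (component b)) (length-gather q bs) ⟩
    q + q * multiplicity size bs q
      ≡⟨ *-suc q _ ⟨
    q * suc (multiplicity size bs q) ∎
    where open ≡-Reasoning

  ∈-gather : ∀ q bs {c} → c ∈ₗ gather q bs → ∃ λ b → b ∈ₗ bs × size b ≡ q × c ∈ component b
  ∈-gather q (b ∷ bs) c∈ with size b ℕ.≟ q
  ... | no  _ = let b′ , b′∈ , rest = ∈-gather q bs c∈ in b′ , there b′∈ , rest
  ... | yes size≡q with ∈-++⁻ (members (component b)) c∈
  ...   | inj₁ c∈b = b , here refl , size≡q , to (∈-members _) c∈b
  ...   | inj₂ c∈bs = let b′ , b′∈ , rest = ∈-gather q bs c∈bs in b′ , there b′∈ , rest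

  gather-unique : ∀ q {bs} → AllPairs (λ a b → ¬ a ~ b) bs → Unique (gather q bs)
  gather-unique q []                   = []
  gather-unique q {b ∷ bs} (b≁bs ∷ bs!) with size b ℕ.≟ q
  ... | no  _ = gather-unique q bs!
  ... | yes _ = Unique.++⁺ (members-unique (component b)) (gather-unique q bs!) disjoint
    where
    disjoint : Disjoint (members (component b)) (gather q bs)
    disjoint (c∈b , c∈bs) =
      let b′ , b′∈ , _ , c∈b′ = ∈-gather q bs c∈bs in
      All.lookup b≁bs b′∈ (transitive _ (to ∈-component (to (∈-members _) c∈b))
                                        (symmetric _ (to ∈-component c∈b′)))

  q*multiplicity≤η : ∀ {q e} → Eta R₀ T q e → q * multiplicity size representatives q ≤ e
  q*multiplicity≤η {q} (S , S≡sized , refl) = begin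
    q * multiplicity size representatives q
      ≡⟨ length-gather q representatives ⟨
    length (gather q representatives)
      ≤⟨ Unique∧⊆⇒length≤ _≟_ (gather-unique q representatives-separated) gather⊆S ⟩
    length (members S)
      ≡⟨ length-members S ⟩
    ∣ S ∣ ∎
    where
    open ≤-Reasoning
    gather⊆S : gather q representatives ⊆ₗ members S
    gather⊆S c∈ with ∈-gather q representatives c∈
    ... | b , _ , refl , c∈b = from (∈-members S) (from (S≡sized _) (component b ,
      (λ y → mk⇔ (λ y∈b → transitive _ (symmetric _ (to ∈-component c∈b)) (to ∈-component y∈b))
                 (λ c~y → from ∈-component (transitive _ (to ∈-component c∈b) c~y))) , refl))


  module _ {η : ℕ → ℕ} (η-spec : ∀ q → 1 ≤ q → q ≤ n → Eta R₀ T q (η q)) where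

    multiplicity≤componentCount : ∀ q → 1 ≤ q → q ≤ n →
                                  multiplicity size representatives q ≤ componentCount η q
    multiplicity≤componentCount q 1≤q q≤n =
      q*m≤η⇒m≤componentCount η 1≤q (q*multiplicity≤η (η-spec q 1≤q q≤n))

    sizes-in-range : All (λ b → 1 ≤ size b × size b ≤ n) representatives
    sizes-in-range = All.tabulate λ {b} _ → size-bounds b

    product-sizes≤ : product (map size representatives) ≤ ∏ n (λ q → q ^ componentCount η q)
    product-sizes≤ = begin
      product (map size representatives)
        ≡⟨ product≡∏multiplicity n size sizes-in-range ⟩
      ∏ n (λ q → q ^ multiplicity size representatives q)
        ≤⟨ ∏-mono-≤ n (λ q 1≤q q≤n →
             ^-monoʳ-≤ q {{>-nonZero 1≤q}} (multiplicity≤componentCount q 1≤q q≤n)) ⟩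
      ∏ n (λ q → q ^ componentCount η q) ∎
      where open ≤-Reasoning

    length-representatives≤ : length representatives ≤ numComps η n
    length-representatives≤ = begin
      length representatives                   ≡⟨ length≡∑multiplicity n size sizes-in-range ⟩
      ∑ n (multiplicity size representatives)  ≤⟨ ∑-mono-≤ n multiplicity≤componentCount ⟩
      ∑ n (componentCount η)                   ≡⟨ numComps≡∑ η n ⟨
      numComps η n                             ∎
      where open ≤-Reasoning

proposition6p5 : (n : ℕ) → 0 < n →
    (rule : Rule n) → (∀ us M → Nonempty M → rule us M ∈ M) →
    (R₀ : Op n) → IsRack R₀ →
    (T₀ : Subset n) → IsT R₀ rule T₀ →
    (η : ℕ → ℕ) → (∀ q → 1 ≤ q → q ≤ n → Eta R₀ T₀ q (η q)) →
    (Rs : List (Op n)) →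
    All (λ R → IsRack R × SameI rule R R₀) Rs →
    AllPairs (λ R R′ → Σ (Fin n) λ x → Σ (Fin n) λ y → R x y ≢ R′ x y) Rs →
    length Rs ≤ twoPowZeta η n
proposition6p5 n _ rule _ R₀ rack₀ T₀ isT₀ η η-spec Rs fibre distinct = begin
  length Rs
    ≤⟨ fibre-length≤ matches distinct ⟩
  product (map size representatives) ^ length representatives
    ≤⟨ ^-≤-twoPowZeta η n (product-sizes≤ η-spec) (length-representatives≤ η-spec) ⟩
  twoPowZeta η n ∎
  where
  open ≤-Reasoning
  open Components R₀ T₀
  open Fibre R₀ rack₀ T₀
  open ComponentSizes R₀ T₀
  matches : All Matches Rs
  matches = All.map (λ (rack , sameI) → SameI⇒Matches isT₀ rack sameI) fibre
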